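{- Every F$_\sigma$ ideal on $\omega$ is an HL ideal.
   Context: Ideals are proper, closed under subsets and finite unions, and contain all finite sets; subsets of $\omega$ are identified with points of $2^\omega$, so F$_\sigma$ refers to the Cantor space topology. $\mathcal I^+=\mathcal P(\omega)\setminus\mathcal I$. A tree is an initial subset of $(2^{<\omega},\subseteq)$ without maximal elements, perfect if every node has two incompatible extensions in it; $\mathbf S$ is the set of perfect trees; $p\restriction A=\{s\in p\cap2^n:n\in A\}$. An ideal $\mathcal I$ is HL if for every $c:2^{<\omega}\to2$ there are $p\in\mathbf S$ and $A\in\mathcal I^+$ with $c$ constant on $p\restriction A$. -}

module Defs where

open import Level using (0ℓ)
open import Data.Nat using (ℕ; zero; suc; _≤_)
open import Data.Bool using (Bool; true; false; _∨_)
open import Data.List using (List; []; _∷_; _++_; length)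
open import Data.Product using (Σ; _×_; ∃; ∃-syntax; _,_)
open import Relation.Nullary using (¬_)
open import Relation.Binary.PropositionalEquality using (_≡_)
open import Function.Bundles using (_⇔_)

-- Subsets of ω are identified with points of Cantor space 2^ω.
Subset : Set
Subset = ℕ → Bool

_∈ˢ_ : ℕ → Subset → Set
n ∈ˢ X = X n ≡ true

_⊆ˢ_ : Subset → Subset → Set
X ⊆ˢ Y = ∀ n → n ∈ˢ X → n ∈ˢ Y

_∪ˢ_ : Subset → Subset → Subset
(X ∪ˢ Y) n = X n ∨ Y n

full : Subset
full _ = true

IsFinite : Subset → Set
IsFinite X = ∃[ N ] (∀ n → N ≤ n → X n ≡ false)

record IsIdeal (I : Subset → Set) : Set where
  field
    proper    : ¬ I full
    hereditary : ∀ X Y → X ⊆ˢ Y → I Y → I X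
    union     : ∀ X Y → I X → I Y → I (X ∪ˢ Y)
    finite    : ∀ X → IsFinite X → I X

Seq : Set
Seq = List Bool

_⊑_ : Seq → Seq → Set
s ⊑ t = ∃[ u ] (s ++ u ≡ t)

_↾_ : Subset → ℕ → Seq
X ↾ zero = []
X ↾ suc n = X 0 ∷ ((λ k → X (suc k)) ↾ n)

IsOpen : (Subset → Set) → Set
IsOpen U = ∀ X → U X → ∃[ n ] (∀ Y → Y ↾ n ≡ X ↾ n → U Y)

IsClosed : (Subset → Set) → Set
IsClosed C = IsOpen (λ X → ¬ C X)

IsFσ : (Subset → Set) → Set₁
IsFσ P = Σ (ℕ → Subset → Set) λ C →
           (∀ n → IsClosed (C n)) × (∀ X → P X ⇔ (∃[ n ] C n X))

record IsPerfectTree (p : Seq → Set) : Set where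
  field
    nonempty : p []
    initial  : ∀ s t → s ⊑ t → p t → p s
    noMax    : ∀ s → p s → ∃[ t ] (s ⊑ t × ¬ (t ≡ s) × p t)
    splitting : ∀ s → p s → ∃[ t ] ∃[ u ]
                  (s ⊑ t × s ⊑ u × p t × p u × ¬ (t ⊑ u) × ¬ (u ⊑ t))

ConstantOn↾ : (Seq → Bool) → (Seq → Set) → Subset → Set
ConstantOn↾ c p A = ∃[ i ] (∀ s → p s → length s ∈ˢ A → c s ≡ i)

IsHL : (Subset → Set) → Set₁
IsHL I = ∀ (c : Seq → Bool) → ∃[ p ] ∃[ A ]
           (IsPerfectTree p × ¬ I A × ConstantOn↾ c p A)

-- Write I = ⋃ C_j with every C_j closed. Either there are a node u and an I-positive B
-- such that along every branch x through u the set {n ∈ B : c (x↾n) = false} lies in I,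
-- or every node has branches keeping colour false on a positive part of any positive B.
-- Either way, any finite list of nodes (above u, resp. arbitrary) has branches through
-- them that all take one colour i along one common positive set. Fusion then builds the
-- tree: at stage j every frontier node is extended along its branch across an interval
-- of that set which is j-large (no superset lies in C_j). Such intervals exist by
-- compactness of 2^ω: otherwise a cluster point of witnesses in C_j would contain a tail
-- of the set. The union A of the intervals lies in no C_j, so A ∉ I, and c is i on the
-- tree at every level in A.
module Submission where

open import Defs
open import Level using (0ℓ)
open import Axiom.ExcludedMiddle using (ExcludedMiddle)
open import Axiom.DoubleNegationElimination using (em⇒dne)
open import Data.Nat using (ℕ; zero; suc; _+_; _⊔_; _≤_; _<_; _≤′_; ≤′-refl; ≤′-step; z≤n; s≤s; _<?_)
open import Data.Nat.Properties
  using (≤-refl; ≤-trans; <⇒≤; <-≤-trans; <-irrefl; m≤m+n; m≤n+m; m≤m⊔n; m≤n⊔m; +-comm; ≤⇒≤′; ≮⇒≥)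
open import Data.Bool using (Bool; true; false; _≟_)
open import Data.Bool.Properties using (∨-zeroʳ; ¬-not)
open import Data.List using (List; []; _∷_; _++_; _∷ʳ_; length; map; cartesianProductWith)
open import Data.List.Properties using (++-assoc; ++-identityʳ; length-++; ∷-injective; ≡-dec)
open import Data.List.Membership.Propositional using (_∈_)
open import Data.List.Membership.Propositional.Properties using (∈-map⁺; ∈-map⁻; ∈-cartesianProductWith⁺; ∈-cartesianProductWith⁻)
open import Data.List.Relation.Unary.Any using (here; there)
open import Data.Product using (Σ; _×_; ∃-syntax; _,_; proj₁; proj₂)
open import Data.Sum using (_⊎_; inj₁; inj₂)
open import Data.Empty using (⊥-elim)
open import Function using (_∘_)
open import Function.Bundles using (_⇔_; Equivalence)
open import Relation.Nullary using (¬_; yes; no; does)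
open import Relation.Binary.PropositionalEquality using (_≡_; _≢_; refl; sym; trans; cong; cong₂; subst; subst₂)

⊑-refl : ∀ s → s ⊑ s
⊑-refl s = [] , ++-identityʳ s

⊑-trans : ∀ {s t r} → s ⊑ t → t ⊑ r → s ⊑ r
⊑-trans {s} (a , refl) (b , refl) = a ++ b , sym (++-assoc s a b)

⊑-++ : ∀ s v → s ⊑ (s ++ v)
⊑-++ s v = v , refl

⊑⇒length-≤ : ∀ {s t} → s ⊑ t → length s ≤ length t
⊑⇒length-≤ {s} (v , refl) = subst (length s ≤_) (sym (length-++ s)) (m≤m+n _ _)

length-∷ʳ : ∀ (s : Seq) b → length (s ∷ʳ b) ≡ suc (length s)
length-∷ʳ s b = trans (length-++ s) (+-comm (length s) 1)

∷ʳ-incomparable : ∀ s {a b} → a ≢ b → ¬ (s ∷ʳ a) ⊑ (s ∷ʳ b)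
∷ʳ-incomparable []      a≢b (v , eq) = a≢b (proj₁ (∷-injective eq))
∷ʳ-incomparable (x ∷ s) a≢b (v , eq) = ∷ʳ-incomparable s a≢b (v , proj₂ (∷-injective eq))

⊑⇒∷ʳ≢ : ∀ {s r} b → s ⊑ r → r ∷ʳ b ≢ s
⊑⇒∷ʳ≢ {s} {r} b s⊑r eq =
  <-irrefl refl (subst (_≤ length r) (trans (cong length (sym eq)) (length-∷ʳ r b)) (⊑⇒length-≤ s⊑r))

length-↾ : ∀ X n → length (X ↾ n) ≡ n
length-↾ X zero    = refl
length-↾ X (suc n) = cong suc (length-↾ (λ k → X (suc k)) n)

↾-mono : ∀ X {m n} → m ≤ n → (X ↾ m) ⊑ (X ↾ n)
↾-mono X {n = n} z≤n = X ↾ n , refl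
↾-mono X (s≤s m≤n) with v , eq ← ↾-mono (λ k → X (suc k)) m≤n = v , cong (X 0 ∷_) eq

⊑-↾ : ∀ s X n → s ⊑ (X ↾ n) → s ≡ X ↾ length s
⊑-↾ []      X n       _        = refl
⊑-↾ (b ∷ s) X zero    (v , ())
⊑-↾ (b ∷ s) X (suc n) (v , eq) with refl , eq′ ← ∷-injective eq =
  cong (X 0 ∷_) (⊑-↾ s (λ k → X (suc k)) n (v , eq′))

↾-≡⇒≡ : ∀ X Y {k n} → X ↾ n ≡ Y ↾ n → k < n → X k ≡ Y k
↾-≡⇒≡ X Y {zero}  {suc n} eq _         = proj₁ (∷-injective eq)
↾-≡⇒≡ X Y {suc k} {suc n} eq (s≤s k<n) =
  ↾-≡⇒≡ (λ m → X (suc m)) (λ m → Y (suc m)) (proj₂ (∷-injective eq)) k<n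

Extends : Subset → Seq → Set
Extends x w = x ↾ length w ≡ w

extend : Seq → Subset
extend []      n       = false
extend (b ∷ w) zero    = b
extend (b ∷ w) (suc n) = extend w n

extend-extends : ∀ w → Extends (extend w) w
extend-extends []      = refl
extend-extends (b ∷ w) = cong (b ∷_) (extend-extends w)

Extends-⊑ : ∀ {x w s} → Extends x w → s ⊑ w → Extends x s
Extends-⊑ {x} {w} {s} x↾w s⊑w = sym (⊑-↾ s x (length w) (subst (s ⊑_) (sym x↾w) s⊑w))

Extends⇒⊑↾ : ∀ {x w n} → Extends x w → length w ≤ n → w ⊑ (x ↾ n)
Extends⇒⊑↾ {x} x↾w w≤n = subst (_⊑ (x ↾ _)) x↾w (↾-mono x w≤n)

⊑-by-length : ∀ {s r t} → s ⊑ t → r ⊑ t → length s ≤ length r → s ⊑ r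
⊑-by-length {s} {r} {t} s⊑t r⊑t s≤r =
  subst₂ _⊑_ (Extends-⊑ (extend-extends t) s⊑t) (Extends-⊑ (extend-extends t) r⊑t)
    (↾-mono (extend t) s≤r)

perfect-if-branching : ∀ (p : Seq → Set) → p [] → (∀ s t → s ⊑ t → p t → p s) →
  (∀ s → p s → ∃[ r ] (s ⊑ r × p (r ∷ʳ false) × p (r ∷ʳ true))) → IsPerfectTree p
perfect-if-branching p p[] initial branching = record
  { nonempty  = p[]
  ; initial   = initial
  ; noMax     = λ s s∈p → let r , s⊑r , r0 , _ = branching s s∈p in
      r ∷ʳ false , ⊑-trans s⊑r (⊑-++ r _) , ⊑⇒∷ʳ≢ false s⊑r , r0
  ; splitting = λ s s∈p → let r , s⊑r , r0 , r1 = branching s s∈p in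
      r ∷ʳ false , r ∷ʳ true , ⊑-trans s⊑r (⊑-++ r _) , ⊑-trans s⊑r (⊑-++ r _) , r0 , r1 ,
      ∷ʳ-incomparable r (λ ()) , ∷ʳ-incomparable r (λ ())
  }

∈-∪ˡ : ∀ X Y {n} → n ∈ˢ X → n ∈ˢ (X ∪ˢ Y)
∈-∪ˡ X Y n∈X rewrite n∈X = refl

∈-∪ʳ : ∀ X Y {n} → n ∈ˢ Y → n ∈ˢ (X ∪ˢ Y)
∈-∪ʳ X Y {n} n∈Y rewrite n∈Y = ∨-zeroʳ (X n)

Frequently : (ℕ → Set) → Set
Frequently P = ∀ M → ∃[ N ] (M ≤ N × P N)

module CantorCompactness (em : ExcludedMiddle 0ℓ) where

  private
    dne = em⇒dne em

  frequent-value : (f : ℕ → Bool) → ∃[ b ] Frequently (λ N → f N ≡ b)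
  frequent-value f with em {Frequently (λ N → f N ≡ true)}
  ... | yes often-true = true , often-true
  ... | no ¬often-true = false , λ M → dne λ never-false → ¬often-true λ M′ →
          M ⊔ M′ , m≤n⊔m M M′ , ¬-not (λ eq → never-false (M ⊔ M′ , m≤m⊔n M M′ , eq))

  headValue : (ℕ → Subset) → Bool
  headValue Y = proj₁ (frequent-value (λ N → Y N 0))

  headIndex : (ℕ → Subset) → ℕ → ℕ
  headIndex Y M = proj₁ (proj₂ (frequent-value (λ N → Y N 0)) M)

  -- The subsequence of Y along which the first bit is headValue Y, with that bit dropped.
  tails : (ℕ → Subset) → ℕ → Subset
  tails Y M k = Y (headIndex Y M) (suc k)

  cluster : (ℕ → Subset) → Subset
  cluster Y zero    = headValue Y
  cluster Y (suc k) = cluster (tails Y) k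

  cluster-approximated : ∀ n Y M → ∃[ N ] (M ≤ N × Y N ↾ n ≡ cluster Y ↾ n)
  cluster-approximated zero    Y M = M , ≤-refl , refl
  cluster-approximated (suc n) Y M
    with N , M≤N , agree ← cluster-approximated n (tails Y) M
    with N≤N′ , head ← proj₂ (proj₂ (frequent-value (λ N → Y N 0)) N)
    = headIndex Y N , ≤-trans M≤N N≤N′ , cong₂ _∷_ head agree

  closed-∋-cluster : ∀ {C} → IsClosed C → ∀ Y → (∀ N → C (Y N)) → C (cluster Y)
  closed-∋-cluster C-closed Y Y∈C = dne λ cluster∉C →
    let n , nbhd⊆∁C = C-closed (cluster Y) cluster∉C
        N , _ , agree = cluster-approximated n Y 0
    in nbhd⊆∁C (Y N) agree (Y∈C N)

  ∈-cluster : ∀ Y k M → (∀ N → M ≤ N → k ∈ˢ Y N) → k ∈ˢ cluster Y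
  ∈-cluster Y k M eventually with N , M≤N , agree ← cluster-approximated (suc k) Y M =
    trans (sym (↾-≡⇒≡ (Y N) (cluster Y) agree ≤-refl)) (eventually N M≤N)

module FσIdeal (em : ExcludedMiddle 0ℓ) (I : Subset → Set) (ideal : IsIdeal I)
               (C : ℕ → Subset → Set) (C-closed : ∀ j → IsClosed (C j))
               (I⇔C : ∀ X → I X ⇔ (∃[ j ] C j X)) where

  open IsIdeal ideal
  open CantorCompactness em

  private
    dne = em⇒dne em

  ⟦_⟧ : (ℕ → Set) → Subset
  ⟦ P ⟧ n = does (em {P n})

  ⟦⟧⁺ : ∀ P {n} → P n → n ∈ˢ ⟦ P ⟧
  ⟦⟧⁺ P {n} Pn with em {P n}
  ... | yes _  = refl
  ... | no ¬Pn = ⊥-elim (¬Pn Pn)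

  ⟦⟧⁻ : ∀ P {n} → n ∈ˢ ⟦ P ⟧ → P n
  ⟦⟧⁻ P {n} n∈P with em {P n}
  ... | yes Pn = Pn

  ⟦⟧⁰ : ∀ P {n} → ¬ P n → ⟦ P ⟧ n ≡ false
  ⟦⟧⁰ P {n} ¬Pn with em {P n}
  ... | yes Pn = ⊥-elim (¬Pn Pn)
  ... | no _   = refl

  ∈I-if-covered : ∀ X Y Z → (∀ n → n ∈ˢ X → n ∈ˢ Y ⊎ n ∈ˢ Z) → I Y → I Z → I X
  ∈I-if-covered X Y Z cover Y∈I Z∈I = hereditary X (Y ∪ˢ Z) X⊆Y∪Z (union Y Z Y∈I Z∈I)
    where
    X⊆Y∪Z : X ⊆ˢ (Y ∪ˢ Z)
    X⊆Y∪Z n n∈X with cover n n∈X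
    ... | inj₁ n∈Y = ∈-∪ˡ Y Z n∈Y
    ... | inj₂ n∈Z = ∈-∪ʳ Y Z n∈Z

  Large : ℕ → Subset → Set
  Large j F = ∀ Y → F ⊆ˢ Y → ¬ C j Y

  infix 25 _∩⟨_,_⟩
  _∩⟨_,_⟩ : Subset → ℕ → ℕ → Subset
  B ∩⟨ ℓ , N ⟩ = ⟦ (λ n → ℓ < n × n < N × n ∈ˢ B) ⟧

  ∈-∩⟨⟩⁺ : ∀ B ℓ N {n} → ℓ < n → n < N → n ∈ˢ B → n ∈ˢ B ∩⟨ ℓ , N ⟩
  ∈-∩⟨⟩⁺ B ℓ N ℓ<n n<N n∈B = ⟦⟧⁺ (λ n → ℓ < n × n < N × n ∈ˢ B) (ℓ<n , n<N , n∈B)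

  ∈-∩⟨⟩⁻ : ∀ B ℓ N {n} → n ∈ˢ B ∩⟨ ℓ , N ⟩ → ℓ < n × n < N × n ∈ˢ B
  ∈-∩⟨⟩⁻ B ℓ N = ⟦⟧⁻ (λ n → ℓ < n × n < N × n ∈ˢ B)

  ∈I-if-no-large-interval : ∀ B j ℓ → (∀ N → ℓ ≤ N → ¬ Large j (B ∩⟨ ℓ , N ⟩)) → I B
  ∈I-if-no-large-interval B j ℓ small = ∈I-if-covered B Z ⟦ (_≤ ℓ) ⟧ cover Z∈I initial∈I
    where
    witness : ∀ N → Σ Subset λ Y → B ∩⟨ ℓ , ℓ + N ⟩ ⊆ˢ Y × C j Y
    witness N = dne λ none → small (ℓ + N) (m≤m+n ℓ N) λ Y F⊆Y Y∈C → none (Y , F⊆Y , Y∈C)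

    Z : Subset
    Z = cluster (proj₁ ∘ witness)

    Z∈I : I Z
    Z∈I = Equivalence.from (I⇔C Z) (j , closed-∋-cluster (C-closed j) _ (proj₂ ∘ proj₂ ∘ witness))

    initial∈I : I ⟦ (_≤ ℓ) ⟧
    initial∈I = finite _ (suc ℓ , λ n ℓ<n → ⟦⟧⁰ (_≤ ℓ) λ n≤ℓ → <-irrefl refl (<-≤-trans ℓ<n n≤ℓ))

    cover : ∀ n → n ∈ˢ B → n ∈ˢ Z ⊎ n ∈ˢ ⟦ (_≤ ℓ) ⟧
    cover n n∈B with ℓ <? n
    ... | yes ℓ<n = inj₁ (∈-cluster _ n (suc n) λ N n<N →
                      proj₁ (proj₂ (witness N)) n (∈-∩⟨⟩⁺ B ℓ (ℓ + N) ℓ<n (<-≤-trans n<N (m≤n+m N ℓ)) n∈B))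
    ... | no ℓ≮n = inj₂ (⟦⟧⁺ (_≤ ℓ) (≮⇒≥ ℓ≮n))

  large-interval : ∀ {B} → ¬ I B → ∀ j ℓ → ∃[ N ] (ℓ ≤ N × Large j (B ∩⟨ ℓ , N ⟩))
  large-interval B∉I j ℓ = dne λ none →
    B∉I (∈I-if-no-large-interval _ j ℓ λ N ℓ≤N large → none (N , ℓ≤N , large))

  ∉I-if-large-for-all : ∀ A → (∀ j → ∃[ F ] (Large j F × F ⊆ˢ A)) → ¬ I A
  ∉I-if-large-for-all A large A∈I =
    let j , A∈C = Equivalence.to (I⇔C A) A∈I
        F , F-large , F⊆A = large j
    in F-large A F⊆A A∈C

  module Colouring (c : Seq → Bool) where

    slice : Subset → Subset → Bool → Subset
    slice B x i = ⟦ (λ n → n ∈ˢ B × c (x ↾ n) ≡ i) ⟧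

    ∈-slice⁺ : ∀ B x {i n} → n ∈ˢ B → c (x ↾ n) ≡ i → n ∈ˢ slice B x i
    ∈-slice⁺ B x {i} n∈B colour = ⟦⟧⁺ (λ n → n ∈ˢ B × c (x ↾ n) ≡ i) (n∈B , colour)

    ∈-slice⁻ : ∀ B x {i n} → n ∈ˢ slice B x i → n ∈ˢ B × c (x ↾ n) ≡ i
    ∈-slice⁻ B x {i} = ⟦⟧⁻ (λ n → n ∈ˢ B × c (x ↾ n) ≡ i)

    record Homogeneous (i : Bool) (W : List Seq) : Set where
      field
        branch           : Seq → Subset
        support          : Subset
        support-positive : ¬ I support
        branch-extends   : ∀ w → w ∈ W → Extends (branch w) w
        coloured         : ∀ w → w ∈ W → ∀ n → n ∈ˢ support → c (branch w ↾ n) ≡ i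

    Homogenizable : Seq → Bool → Set
    Homogenizable u i = ∀ W → (∀ w → w ∈ W → u ⊑ w) → Homogeneous i W

    override : Seq → Subset → (Seq → Subset) → Seq → Subset
    override w x br s with ≡-dec _≟_ s w
    ... | yes _ = x
    ... | no _  = br s

    override-∈ : ∀ (P : Seq → Subset → Set) {w x br W} → P w x → (∀ s → s ∈ W → P s (br s)) →
      ∀ s → s ∈ w ∷ W → P s (override w x br s)
    override-∈ P {w} Pwx Pbr s s∈ with ≡-dec _≟_ s w | s∈
    ... | yes refl | _          = Pwx
    ... | no s≢w   | here s≡w   = ⊥-elim (s≢w s≡w)
    ... | no _     | there s∈W  = Pbr s s∈W

    homogeneous-by-shrinking : ∀ (Admissible : Subset → Set) i W →
      (∀ {B} → Admissible B → ¬ I B) →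
      (∀ w → w ∈ W → ∀ B → Admissible B → ∃[ x ] (Extends x w × Admissible (slice B x i))) →
      ∀ B → Admissible B → Σ (Homogeneous i W) λ H → Homogeneous.support H ⊆ˢ B
    homogeneous-by-shrinking Adm i [] positive _ B B-adm =
      record
        { branch = extend ; support = B ; support-positive = positive B-adm
        ; branch-extends = λ _ () ; coloured = λ _ () } ,
      λ _ n∈B → n∈B
    homogeneous-by-shrinking Adm i (w ∷ W) positive shrink B B-adm
      with x , x-extends , slice-adm ← shrink w (here refl) B B-adm
      with H , H⊆slice ← homogeneous-by-shrinking Adm i W positive (λ v → shrink v ∘ there)
                             (slice B x i) slice-adm
      = record
          { branch           = override w x branch
          ; support          = support
          ; support-positive = support-positive
          ; branch-extends   = override-∈ (λ s y → Extends y s) x-extends branch-extends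
          ; coloured         = override-∈ (λ s y → ∀ n → n ∈ˢ support → c (y ↾ n) ≡ i)
                                 (λ n n∈S → proj₂ (∈-slice⁻ B x (H⊆slice n n∈S))) coloured
          } ,
        λ n n∈S → proj₁ (∈-slice⁻ B x (H⊆slice n n∈S))
      where open Homogeneous H

    homogenizable-false : (∀ w B → ¬ I B → ∃[ x ] (Extends x w × ¬ I (slice B x false))) →
      Homogenizable [] false
    homogenizable-false dense W _ =
      proj₁ (homogeneous-by-shrinking (λ B → ¬ I B) false W (λ B∉I → B∉I)
               (λ w _ → dense w) full proper)

    homogenizable-true : ∀ u B₀ → ¬ I B₀ → (∀ x → Extends x u → I (slice B₀ x false)) →
      Homogenizable u true
    homogenizable-true u B₀ B₀∉I thin W u⊑W =
      proj₁ (homogeneous-by-shrinking Admissible true W proj₂ shrink B₀ ((λ _ n∈B → n∈B) , B₀∉I))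
      where
      Admissible : Subset → Set
      Admissible B = B ⊆ˢ B₀ × ¬ I B

      -- B is covered by its true-slice and the false-slice of B₀, and the latter is in I.
      shrink : ∀ w → w ∈ W → ∀ B → Admissible B → ∃[ x ] (Extends x w × Admissible (slice B x true))
      shrink w w∈W B (B⊆B₀ , B∉I) =
        extend w , extend-extends w , (λ n n∈ → B⊆B₀ n (proj₁ (∈-slice⁻ B (extend w) n∈))) , λ slice∈I →
          B∉I (∈I-if-covered B _ _ cover slice∈I
                 (thin (extend w) (Extends-⊑ (extend-extends w) (u⊑W w w∈W))))
        where
        cover : ∀ n → n ∈ˢ B → n ∈ˢ slice B (extend w) true ⊎ n ∈ˢ slice B₀ (extend w) false
        cover n n∈B with c (extend w ↾ n) ≟ true
        ... | yes true-colour = inj₁ (∈-slice⁺ B (extend w) n∈B true-colour)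
        ... | no ¬true-colour = inj₂ (∈-slice⁺ B₀ (extend w) (B⊆B₀ n n∈B) (¬-not ¬true-colour))

    homogenizable : ∃[ u ] ∃[ i ] Homogenizable u i
    homogenizable with em {∃[ u ] ∃[ B ] (¬ I B × ∀ x → Extends x u → I (slice B x false))}
    ... | yes (u , B₀ , B₀∉I , thin) = u , true , homogenizable-true u B₀ B₀∉I thin
    ... | no none = [] , false , homogenizable-false λ w B B∉I → dne λ no-x →
                      none (w , B , B∉I , λ x x-extends → dne λ slice∉I → no-x (x , x-extends , slice∉I))

    module Fusion (u : Seq) (i : Bool) (hom : Homogenizable u i) where

      record Frontier : Set where
        field
          nodes        : List Seq
          level        : ℕ
          nodes-length : ∀ w → w ∈ nodes → length w ≡ level
          nodes-extend : ∀ w → w ∈ nodes → u ⊑ w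

      bits : ∀ b → b ∈ false ∷ true ∷ []
      bits false = here refl
      bits true  = there (here refl)

      module Step (j : ℕ) (F : Frontier) where
        open Frontier F public
        open Homogeneous (hom nodes nodes-extend) public

        interval : ∃[ N ] (level ≤ N × Large j (support ∩⟨ level , N ⟩))
        interval = large-interval support-positive j level

        bound : ℕ
        bound = proj₁ interval

        level≤bound : level ≤ bound
        level≤bound = proj₁ (proj₂ interval)

        large : Large j (support ∩⟨ level , bound ⟩)
        large = proj₂ (proj₂ interval)

        cut : Seq → Seq
        cut w = branch w ↾ bound

        ⊑-cut : ∀ w → w ∈ nodes → w ⊑ cut w
        ⊑-cut w w∈ = Extends⇒⊑↾ (branch-extends w w∈)
                       (subst (_≤ bound) (sym (nodes-length w w∈)) level≤bound)

        children : List Seq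
        children = cartesianProductWith _∷ʳ_ (map cut nodes) (false ∷ true ∷ [])

        ∈-children⁺ : ∀ {w} → w ∈ nodes → ∀ b → cut w ∷ʳ b ∈ children
        ∈-children⁺ w∈ b = ∈-cartesianProductWith⁺ _∷ʳ_ (∈-map⁺ cut w∈) (bits b)

        ∈-children⁻ : ∀ {t} → t ∈ children → ∃[ w ] ∃[ b ] (w ∈ nodes × t ≡ cut w ∷ʳ b)
        ∈-children⁻ t∈
          with q , b , q∈ , _ , refl ← ∈-cartesianProductWith⁻ _∷ʳ_ (map cut nodes) _ t∈
          with w , w∈ , refl ← ∈-map⁻ cut q∈
          = w , b , w∈ , refl

        next : Frontier
        next = record
          { nodes        = children
          ; level        = suc bound
          ; nodes-length = λ t t∈ → let w , b , w∈ , t≡ = ∈-children⁻ t∈ in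
              subst (λ t → length t ≡ suc bound) (sym t≡)
                (trans (length-∷ʳ (cut w) b) (cong suc (length-↾ (branch w) bound)))
          ; nodes-extend = λ t t∈ → let w , b , w∈ , t≡ = ∈-children⁻ t∈ in
              subst (u ⊑_) (sym t≡)
                (⊑-trans (nodes-extend w w∈) (⊑-trans (⊑-cut w w∈) (⊑-++ (cut w) _)))
          }

      frontier : ℕ → Frontier
      frontier zero = record
        { nodes        = u ∷ []
        ; level        = length u
        ; nodes-length = λ { _ (here refl) → refl }
        ; nodes-extend = λ { _ (here refl) → ⊑-refl u }
        }
      frontier (suc j) = Step.next j (frontier j)

      module Stage (j : ℕ) = Step j (frontier j)
      open Stage

      level-mono : ∀ {j j′} → j ≤′ j′ → level j ≤ level j′
      level-mono ≤′-refl       = ≤-refl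
      level-mono (≤′-step j≤j′) =
        ≤-trans (level-mono j≤j′) (≤-trans (level≤bound _) (m≤n+m _ 1))

      ancestor : ∀ {j j′ t} → suc j ≤′ j′ → t ∈ nodes j′ →
        ∃[ w ] ∃[ b ] (w ∈ nodes j × (cut j w ∷ʳ b) ⊑ t)
      ancestor {j} ≤′-refl t∈ with w , b , w∈ , refl ← ∈-children⁻ j t∈ = w , b , w∈ , ⊑-refl _
      ancestor {j} {suc j″} (≤′-step j<j″) t∈
        with w′ , b′ , w′∈ , refl ← ∈-children⁻ j″ t∈
        with w , b , w∈ , below ← ancestor j<j″ w′∈
        = w , b , w∈ , ⊑-trans below (⊑-trans (⊑-cut j″ w′ w′∈) (⊑-++ _ _))

      InTree : Seq → Set
      InTree s = ∃[ j ] ∃[ t ] (t ∈ nodes j × s ⊑ t)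

      tree-perfect : IsPerfectTree InTree
      tree-perfect = perfect-if-branching InTree (0 , u , here refl , (u , refl))
        (λ s t s⊑t (j , t′ , t′∈ , t⊑t′) → j , t′ , t′∈ , ⊑-trans s⊑t t⊑t′)
        λ s (j , t , t∈ , s⊑t) →
          cut j t , ⊑-trans s⊑t (⊑-cut j t t∈) ,
          (suc j , _ , ∈-children⁺ j t∈ false , ⊑-refl _) ,
          (suc j , _ , ∈-children⁺ j t∈ true , ⊑-refl _)

      InSomeInterval : ℕ → Set
      InSomeInterval n = ∃[ j ] n ∈ˢ support j ∩⟨ level j , bound j ⟩

      A : Subset
      A = ⟦ InSomeInterval ⟧

      A-positive : ¬ I A
      A-positive = ∉I-if-large-for-all A λ j →
        _ , large j , λ n n∈ → ⟦⟧⁺ InSomeInterval (j , n∈)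

      -- A node at a level in the j-th interval lies strictly above frontier j, hence below
      -- some cut j w, so it is an initial segment of the branch through w.
      tree-coloured : ∀ s → InTree s → length s ∈ˢ A → c s ≡ i
      tree-coloured s (j′ , t , t∈ , s⊑t) |s|∈A
        with j , |s|∈interval ← ⟦⟧⁻ InSomeInterval |s|∈A
        with level<|s| , |s|<bound , |s|∈support ← ∈-∩⟨⟩⁻ (support j) (level j) (bound j) |s|∈interval
        with j <? j′
      ... | no j≮j′ = ⊥-elim (<-irrefl refl (<-≤-trans level<|s|
                        (≤-trans (⊑⇒length-≤ s⊑t)
                          (subst (_≤ level j) (sym (nodes-length j′ t t∈)) (level-mono (≤⇒≤′ (≮⇒≥ j≮j′)))))))
      ... | yes j<j′ with w , b , w∈ , cut∷b⊑t ← ancestor (≤⇒≤′ j<j′) t∈ =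
        trans (cong c (⊑-↾ s (branch j w) (bound j) s⊑cut)) (coloured j w w∈ (length s) |s|∈support)
        where
        s⊑cut : s ⊑ cut j w
        s⊑cut = ⊑-by-length s⊑t (⊑-trans (⊑-++ (cut j w) _) cut∷b⊑t)
                  (subst (length s ≤_) (sym (length-↾ (branch j w) (bound j))) (<⇒≤ |s|<bound))

corollary3p4 : ExcludedMiddle 0ℓ →
    ∀ (I : Subset → Set) → IsIdeal I → IsFσ I → IsHL I
corollary3p4 em I ideal (C , C-closed , I⇔C) c =
  let u , i , hom = homogenizable
      open Fusion u i hom
  in InTree , A , tree-perfect , A-positive , i , tree-coloured
  where
  open FσIdeal em I ideal C C-closed I⇔C
  open Colouring c
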